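{- Let $(E,\varphi)$ be a violator space with extreme point operator $ex$. The following are equivalent: (i) $(E,\varphi)$ is uniquely generated; (ii) for all $X,Y\subseteq E$, if $ex(X)\subseteq Y\subseteq X$ then $ex(X)=ex(Y)$; (iii) for all $X\subseteq E$, $\varphi(ex(X))=\varphi(X)$; (iv) for all $X\subseteq E$, $ex(\varphi(X))=ex(X)$.
   Context: A violator space is a pair $(E,\varphi)$ with $E$ finite and $\varphi:2^E\to 2^E$ such that for all $X,Y\subseteq E$: (V1) $X\subseteq\varphi(X)$, and (V2) if $X\subseteq Y\subseteq\varphi(X)$ then $\varphi(X)=\varphi(Y)$. For $X\subseteq E$, a basis of $X$ is an inclusion-minimal set $B\subseteq E$ (not necessarily contained in $X$) with $\varphi(B)=\varphi(X)$; the space is uniquely generated if every $X\subseteq E$ has exactly one basis. The extreme point operator is $ex(X)=\{x\in X: x\notin\varphi(X\setminus\{x\})\}$. -}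

module Defs where

open import Data.Nat using (ℕ)
open import Data.Bool using (Bool; _∧_; not)
open import Data.Vec using (tabulate; lookup)
open import Data.Fin.Subset using (Subset; _⊆_; _-_)
open import Data.Product using (_×_; Σ-syntax)
open import Relation.Binary.PropositionalEquality using (_≡_)
open import Relation.Nullary using (¬_)

-- The ground set E is Fin n; subsets of E are Subset n (characteristic vectors).

record IsViolatorSpace {n : ℕ} (φ : Subset n → Subset n) : Set where
  field
    V1 : ∀ X → X ⊆ φ X
    V2 : ∀ X Y → X ⊆ Y → Y ⊆ φ X → φ X ≡ φ Y

-- B is a basis of X: inclusion-minimal among sets B' with φ B' ≡ φ X
-- (B not necessarily contained in X).
IsBasis : {n : ℕ} → (Subset n → Subset n) → Subset n → Subset n → Set
IsBasis φ X B = (φ B ≡ φ X) × (∀ B' → B' ⊆ B → φ B' ≡ φ X → B ⊆ B')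

UniquelyGenerated : {n : ℕ} → (Subset n → Subset n) → Set
UniquelyGenerated {n} φ =
  ∀ (X : Subset n) → Σ[ B ∈ Subset n ] (IsBasis φ X B × (∀ B' → IsBasis φ X B' → B' ≡ B))

ex : {n : ℕ} → (Subset n → Subset n) → Subset n → Subset n
ex φ X = tabulate (λ x → lookup X x ∧ not (lookup (φ (X - x)) x))

-- Two facts hold in every violator space: a generating set B ⊆ X (φ B = φ X)
-- contains ex X, and deleting a non-extreme point x of X (x ∈ φ (X - x)) leaves
-- φ X unchanged. Deleting non-extreme points one at a time therefore produces a
-- basis of X inside X. In a uniquely generated space this basis contains no
-- non-extreme point y, since X - y has a basis of its own; so it is ex X and
-- (iii) holds. Conversely, under (iii) a basis B of X is also one of X ∪ B,
-- hence lies in ex (X ∪ B) ⊆ X, and minimality squeezes it to ex X: ex X is the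
-- unique basis. Then ex X depends only on φ X, which gives (ii) and (iv); each
-- of these makes ex invariant under deleting non-extreme points, and the same
-- removal induction gives back (iii).
module Submission where

open import Defs
open import Data.Nat using (ℕ)
open import Data.Bool using (true; false; _∧_; not)
open import Data.Bool.Properties using (¬-not; not-¬)
open import Data.Empty using (⊥-elim)
open import Data.Fin using (Fin; _≟_)
open import Data.Fin.Properties using (any?)
open import Data.Fin.Subset using (Subset; _⊆_; _⊂_; _∈_; _∉_; _-_; _─_; _∪_; ⁅_⁆)
open import Data.Fin.Subset.Properties
  using (_∈?_; ⊆-refl; ⊆-trans; ⊆-antisym; p⊆p∪q; q⊆p∪q; x∈p∪q⁻; p─q⊆p;
         x∈⁅x⁆; x∈p∧x≢y⇒x∈p-y; x∈p⇒p-x⊂p)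
open import Data.Fin.Subset.Induction using (⊂-wellFounded)
open import Data.Product using (_×_; _,_; proj₁; proj₂; Σ-syntax)
open import Data.Sum using (inj₁; inj₂)
open import Data.Vec using (_∷_; lookup; here; there)
open import Data.Vec.Properties using (lookup∘tabulate; []=⇒lookup; lookup⇒[]=)
open import Function using (_∘_)
open import Function.Bundles using (_⇔_; mk⇔)
open import Induction.WellFounded using (module All)
open import Relation.Binary.PropositionalEquality
  using (_≡_; refl; sym; trans; cong; cong₂; subst; module ≡-Reasoning)
open import Relation.Nullary using (yes; no)
open import Relation.Nullary.Decidable using (_×-dec_)

private
  variable
    n : ℕ

∧-not≡true : ∀ {b c} → b ∧ not c ≡ true → b ≡ true × c ≡ false
∧-not≡true {true}  {false} refl = refl , refl
∧-not≡true {true}  {true}  ()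
∧-not≡true {false} {_}     ()

x∈p─q⇒x∉q : (p q : Subset n) {x : Fin n} → x ∈ p ─ q → x ∉ q
x∈p─q⇒x∉q (_ ∷ p) (true ∷ q) ()            here
x∈p─q⇒x∉q (_ ∷ p) (_    ∷ q) (there x∈p─q) (there x∈q) = x∈p─q⇒x∉q p q x∈p─q x∈q

x∉p-x : (p : Subset n) (x : Fin n) → x ∉ p - x
x∉p-x p x x∈p-x = x∈p─q⇒x∉q p ⁅ x ⁆ x∈p-x (x∈⁅x⁆ x)

p-x⊆p : (p : Subset n) (x : Fin n) → p - x ⊆ p
p-x⊆p p x = p─q⊆p p ⁅ x ⁆

module _ (φ : Subset n → Subset n) {X : Subset n} {x : Fin n} where

  ∈-ex⁺ : x ∈ X → x ∉ φ (X - x) → x ∈ ex φ X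
  ∈-ex⁺ x∈X x∉φ = lookup⇒[]= x (ex φ X) (begin
    lookup (ex φ X) x                           ≡⟨ lookup∘tabulate _ x ⟩
    lookup X x ∧ not (lookup (φ (X - x)) x)     ≡⟨ cong₂ (λ b c → b ∧ not c) ([]=⇒lookup x∈X)
                                                     (¬-not (x∉φ ∘ lookup⇒[]= x (φ (X - x)))) ⟩
    true                                        ∎)
    where open ≡-Reasoning

  ∈-ex⁻ : x ∈ ex φ X → x ∈ X × x ∉ φ (X - x)
  ∈-ex⁻ x∈ex with ∧-not≡true (trans (sym (lookup∘tabulate _ x)) ([]=⇒lookup x∈ex))
  ... | X[x]≡true , φ[x]≡false = lookup⇒[]= x X X[x]≡true , not-¬ φ[x]≡false ∘ []=⇒lookup

ex⊆ : (φ : Subset n → Subset n) {X : Subset n} → ex φ X ⊆ X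
ex⊆ φ = proj₁ ∘ ∈-ex⁻ φ

ex-induction : (φ : Subset n → Subset n) (P : Subset n → Set) →
  (∀ X → ex φ X ≡ X → P X) →
  (∀ {X x} → x ∈ X → x ∈ φ (X - x) → P (X - x) → P X) →
  ∀ X → P X
ex-induction φ P base step = All.wfRec ⊂-wellFounded _ P removal
  where
  removal : ∀ X → (∀ {Y} → Y ⊂ X → P Y) → P X
  removal X ih with any? (λ x → x ∈? X ×-dec x ∈? φ (X - x))
  ... | yes (x , x∈X , x∈φ) = step x∈X x∈φ (ih (x∈p⇒p-x⊂p x∈X))
  ... | no ∄ = base X (⊆-antisym (ex⊆ φ)
                                 (λ x∈X → ∈-ex⁺ φ x∈X (λ x∈φ → ∄ (_ , x∈X , x∈φ))))

∈φ-remove⇒ex⊆ : (φ : Subset n → Subset n) {X : Subset n} {x : Fin n} →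
  x ∈ φ (X - x) → ex φ X ⊆ X - x
∈φ-remove⇒ex⊆ φ x∈φ y∈ex with ∈-ex⁻ φ y∈ex
... | y∈X , y∉φ = x∈p∧x≢y⇒x∈p-y y∈X (λ { refl → y∉φ x∈φ })

ExRemovalStable : (Subset n → Subset n) → Set
ExRemovalStable {n} φ =
  ∀ {X : Subset n} {x} → x ∈ X → x ∈ φ (X - x) → ex φ (X - x) ≡ ex φ X

ex-between⇒ExRemovalStable : (φ : Subset n → Subset n) →
  (∀ X Y → ex φ X ⊆ Y → Y ⊆ X → ex φ X ≡ ex φ Y) → ExRemovalStable φ
ex-between⇒ExRemovalStable φ ex-between {X} {x} _ x∈φ =
  sym (ex-between X (X - x) (∈φ-remove⇒ex⊆ φ x∈φ) (p-x⊆p X x))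

IsBasis-cong : {φ : Subset n → Subset n} {X Y B : Subset n} →
  IsBasis φ X B → φ X ≡ φ Y → IsBasis φ Y B
IsBasis-cong (φB≡φX , minimal) φX≡φY =
  trans φB≡φX φX≡φY , λ B′ B′⊆B φB′≡φY → minimal B′ B′⊆B (trans φB′≡φY (sym φX≡φY))

ExIsUniqueBasis : (Subset n → Subset n) → Set
ExIsUniqueBasis {n} φ =
  ∀ (X : Subset n) → IsBasis φ X (ex φ X) × (∀ B → IsBasis φ X B → B ≡ ex φ X)

ExIsUniqueBasis⇒UniquelyGenerated : {φ : Subset n → Subset n} →
  ExIsUniqueBasis φ → UniquelyGenerated φ
ExIsUniqueBasis⇒UniquelyGenerated unique X = _ , unique X

ExIsUniqueBasis⇒ex-resp-φ : {φ : Subset n → Subset n} →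
  ExIsUniqueBasis φ → ∀ {X Y} → φ X ≡ φ Y → ex φ X ≡ ex φ Y
ExIsUniqueBasis⇒ex-resp-φ {φ = φ} unique {X} {Y} φX≡φY =
  sym (proj₂ (unique X) (ex φ Y) (IsBasis-cong (proj₁ (unique Y)) (sym φX≡φY)))

module ViolatorSpace {φ : Subset n → Subset n} (vs : IsViolatorSpace φ) where
  open IsViolatorSpace vs

  φ-idem : ∀ X → φ (φ X) ≡ φ X
  φ-idem X = sym (V2 X (φ X) (V1 X) ⊆-refl)

  φ-remove : ∀ {X x} → x ∈ X → x ∈ φ (X - x) → φ (X - x) ≡ φ X
  φ-remove {X} {x} x∈X x∈φ = V2 (X - x) X (p-x⊆p X x) X⊆φ[X-x]
    where
    X⊆φ[X-x] : X ⊆ φ (X - x)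
    X⊆φ[X-x] {y} y∈X with y ≟ x
    ... | yes refl = x∈φ
    ... | no y≢x = V1 (X - x) (x∈p∧x≢y⇒x∈p-y y∈X y≢x)

  φ-between : ∀ {B Y X} → φ B ≡ φ X → B ⊆ Y → Y ⊆ X → φ X ≡ φ Y
  φ-between {B} {Y} {X} φB≡φX B⊆Y Y⊆X =
    trans (sym φB≡φX) (V2 B Y B⊆Y (subst (Y ⊆_) (sym φB≡φX) (V1 X ∘ Y⊆X)))

  φ-∪ : ∀ {B X} → φ B ≡ φ X → φ X ≡ φ (X ∪ B)
  φ-∪ {B} {X} φB≡φX = V2 X (X ∪ B) (p⊆p∪q B) X∪B⊆φX
    where
    X∪B⊆φX : X ∪ B ⊆ φ X
    X∪B⊆φX y∈X∪B with x∈p∪q⁻ X B y∈X∪B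
    ... | inj₁ y∈X = V1 X y∈X
    ... | inj₂ y∈B = subst (_ ∈_) φB≡φX (V1 B y∈B)

  φ≡⇒ex⊆ : ∀ {B X} → B ⊆ X → φ B ≡ φ X → ex φ X ⊆ B
  φ≡⇒ex⊆ {B} {X} B⊆X φB≡φX {y} y∈ex with y ∈? B | ∈-ex⁻ φ y∈ex
  ... | yes y∈B | _ = y∈B
  ... | no y∉B | y∈X , y∉φ = ⊥-elim (y∉φ (subst (y ∈_) φX≡φ[X-y] (V1 X y∈X)))
    where
    φX≡φ[X-y] : φ X ≡ φ (X - y)
    φX≡φ[X-y] = φ-between φB≡φX (λ z∈B → x∈p∧x≢y⇒x∈p-y (B⊆X z∈B) (λ { refl → y∉B z∈B }))
                                (p-x⊆p X y)

  BasisInside : Subset n → Set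
  BasisInside X = Σ[ B ∈ Subset n ] (B ⊆ X × IsBasis φ X B)

  ∃-basis⊆ : ∀ X → BasisInside X
  ∃-basis⊆ = ex-induction φ _ base step
    where
    base : ∀ X → ex φ X ≡ X → BasisInside X
    base X ex≡X = X , ⊆-refl , refl , λ B B⊆X φB≡φX → subst (_⊆ B) ex≡X (φ≡⇒ex⊆ B⊆X φB≡φX)
    step : ∀ {X x} → x ∈ X → x ∈ φ (X - x) → BasisInside (X - x) → BasisInside X
    step {X} {x} x∈X x∈φ (B , B⊆X-x , basis) =
      B , ⊆-trans B⊆X-x (p-x⊆p X x) , IsBasis-cong basis (φ-remove x∈X x∈φ)

  UniquelyGenerated⇒φ-ex : UniquelyGenerated φ → ∀ X → φ (ex φ X) ≡ φ X
  UniquelyGenerated⇒φ-ex ug X with ∃-basis⊆ X | ug X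
  ... | B , B⊆X , basis | _ , _ , unique =
    trans (cong φ (⊆-antisym (φ≡⇒ex⊆ B⊆X (proj₁ basis)) B⊆ex)) (proj₁ basis)
    where
    B⊆ex : B ⊆ ex φ X
    B⊆ex {y} y∈B = ∈-ex⁺ φ (B⊆X y∈B) y∉φ
      where
      y∉φ : y ∉ φ (X - y)
      y∉φ y∈φ with ∃-basis⊆ (X - y)
      ... | B′ , B′⊆X-y , basis′ = x∉p-x X y (B′⊆X-y (subst (y ∈_) B≡B′ y∈B))
        where
        B≡B′ : B ≡ B′
        B≡B′ = trans (unique B basis)
                     (sym (unique B′ (IsBasis-cong basis′ (φ-remove (B⊆X y∈B) y∈φ))))

  module _ (φ-ex≡φ : ∀ X → φ (ex φ X) ≡ φ X) where

    basis⊆ : ∀ {X B} → IsBasis φ X B → B ⊆ X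
    basis⊆ {X} {B} (φB≡φX , minimal) =
      ⊆-trans (minimal (ex φ (X ∪ B)) (φ≡⇒ex⊆ (q⊆p∪q X B) (trans φB≡φX φX≡φ[X∪B]))
                                      (trans (φ-ex≡φ (X ∪ B)) (sym φX≡φ[X∪B])))
              (φ≡⇒ex⊆ (p⊆p∪q B) φX≡φ[X∪B])
      where
      φX≡φ[X∪B] : φ X ≡ φ (X ∪ B)
      φX≡φ[X∪B] = φ-∪ φB≡φX

    φ-ex⇒ExIsUniqueBasis : ExIsUniqueBasis φ
    φ-ex⇒ExIsUniqueBasis X = ex-isBasis , basis≡ex
      where
      ex-isBasis : IsBasis φ X (ex φ X)
      ex-isBasis = φ-ex≡φ X , λ B B⊆ex φB≡φX → φ≡⇒ex⊆ (⊆-trans B⊆ex (ex⊆ φ)) φB≡φX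
      basis≡ex : ∀ B → IsBasis φ X B → B ≡ ex φ X
      basis≡ex B basis@(φB≡φX , minimal) =
        ⊆-antisym (minimal (ex φ X) ex⊆B (φ-ex≡φ X)) ex⊆B
        where
        ex⊆B : ex φ X ⊆ B
        ex⊆B = φ≡⇒ex⊆ (basis⊆ basis) φB≡φX

  ExRemovalStable⇒φ-ex : ExRemovalStable φ → ∀ X → φ (ex φ X) ≡ φ X
  ExRemovalStable⇒φ-ex stable = ex-induction φ _ (λ _ → cong φ) step
    where
    open ≡-Reasoning
    step : ∀ {X x} → x ∈ X → x ∈ φ (X - x) → φ (ex φ (X - x)) ≡ φ (X - x) → φ (ex φ X) ≡ φ X
    step {X} {x} x∈X x∈φ ih = begin
      φ (ex φ X)         ≡⟨ cong φ (sym (stable x∈X x∈φ)) ⟩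
      φ (ex φ (X - x))   ≡⟨ ih ⟩
      φ (X - x)          ≡⟨ φ-remove x∈X x∈φ ⟩
      φ X                ∎

  φ-ex⇒UniquelyGenerated : (∀ X → φ (ex φ X) ≡ φ X) → UniquelyGenerated φ
  φ-ex⇒UniquelyGenerated = ExIsUniqueBasis⇒UniquelyGenerated ∘ φ-ex⇒ExIsUniqueBasis

  UniquelyGenerated⇒ex-resp-φ : UniquelyGenerated φ → ∀ {X Y} → φ X ≡ φ Y → ex φ X ≡ ex φ Y
  UniquelyGenerated⇒ex-resp-φ =
    ExIsUniqueBasis⇒ex-resp-φ ∘ φ-ex⇒ExIsUniqueBasis ∘ UniquelyGenerated⇒φ-ex

  UniquelyGenerated⇒ex-between : UniquelyGenerated φ →
    ∀ X Y → ex φ X ⊆ Y → Y ⊆ X → ex φ X ≡ ex φ Y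
  UniquelyGenerated⇒ex-between ug X Y ex⊆Y Y⊆X =
    UniquelyGenerated⇒ex-resp-φ ug (φ-between (UniquelyGenerated⇒φ-ex ug X) ex⊆Y Y⊆X)

  UniquelyGenerated⇒ex-φ : UniquelyGenerated φ → ∀ X → ex φ (φ X) ≡ ex φ X
  UniquelyGenerated⇒ex-φ ug X = UniquelyGenerated⇒ex-resp-φ ug (φ-idem X)

  ex-φ⇒ExRemovalStable : (∀ X → ex φ (φ X) ≡ ex φ X) → ExRemovalStable φ
  ex-φ⇒ExRemovalStable ex-φ {X} {x} x∈X x∈φ = begin
    ex φ (X - x)       ≡⟨ sym (ex-φ (X - x)) ⟩
    ex φ (φ (X - x))   ≡⟨ cong (ex φ) (φ-remove x∈X x∈φ) ⟩
    ex φ (φ X)         ≡⟨ ex-φ X ⟩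
    ex φ X             ∎
    where open ≡-Reasoning

proposition7 : (n : ℕ) (φ : Subset n → Subset n) → IsViolatorSpace φ →
    ((UniquelyGenerated φ ⇔ (∀ X Y → ex φ X ⊆ Y → Y ⊆ X → ex φ X ≡ ex φ Y))
    × ((UniquelyGenerated φ ⇔ (∀ X → φ (ex φ X) ≡ φ X))
    × (UniquelyGenerated φ ⇔ (∀ X → ex φ (φ X) ≡ ex φ X))))
proposition7 n φ vs =
    mk⇔ UniquelyGenerated⇒ex-between
        (φ-ex⇒UniquelyGenerated ∘ ExRemovalStable⇒φ-ex ∘ ex-between⇒ExRemovalStable φ)
  , mk⇔ UniquelyGenerated⇒φ-ex φ-ex⇒UniquelyGenerated
  , mk⇔ UniquelyGenerated⇒ex-φ
        (φ-ex⇒UniquelyGenerated ∘ ExRemovalStable⇒φ-ex ∘ ex-φ⇒ExRemovalStable)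
  where open ViolatorSpace vs
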